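{- Let $L\in{}^*\mathbb Z^k$ be finite-generic with respect to $\Omega_\mathfrak p$, and let $f:{}^*\mathbb Z^k\to{}^*\mathbb Z$ be a function definable in the structure $({}^*\mathbb Z;\Omega_\mathfrak p)$ such that $f(\mathbb N^k)\subseteq\mathbb N$. Then $f(L)$ is finite-generic with respect to $\Omega_\mathfrak p$ and $f(L)\ge0$.
   Context: Let $P$ be the set of prime numbers, $D$ a non-principal ultrafilter on $P$, ${}^*\mathbb Z=\mathbb Z^P/D$ (non-standard integers), with $\mathbb N\subset{}^*\mathbb Z$ the standard natural numbers. Fix a prime $\mathfrak p$ of ${}^*\mathbb Z$, an element $\mathbf i\in{}^*\mathbb Z$ and an element $\epsilon\in{\rm F}_\mathfrak p={}^*\mathbb Z/\mathfrak p$ (represented by an element of ${}^*\mathbb Z$ between $0$ and $\mathfrak p-1$). $({}^*\mathbb Z;\Omega_\mathfrak p)$ denotes the structure $({}^*\mathbb Z;+,\cdot,\mathfrak p,\epsilon,\mathbf i)$ (ring of non-standard integers with these constants); definable means first-order definable in this structure without further parameters. A tuple $L\in{}^*\mathbb Z^k$ is finite-generic with respect to $\Omega_\mathfrak p$ if for every formula $\Phi(\bar x)$ in the language of $({}^*\mathbb Z;\Omega_\mathfrak p)$: if $({}^*\mathbb Z;\Omega_\mathfrak p)\models\Phi(\bar l)$ for every $\bar l\in\mathbb N^k$, then $({}^*\mathbb Z;\Omega_\mathfrak p)\models\Phi(L)$. -}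

module Defs where

open import Data.Nat using (ℕ)
open import Data.Nat.Primality using (Prime)
open import Data.Integer as ℤ using (ℤ; +_)
open import Data.Fin using (Fin; zero; suc)
open import Data.Product using (Σ; _×_; ∃; ∃-syntax; proj₁)
open import Data.Sum using (_⊎_)
open import Data.Unit using (⊤)
open import Data.Empty using (⊥)
open import Relation.Nullary using (¬_)
open import Relation.Binary.PropositionalEquality using (_≡_)

P : Set
P = Σ ℕ Prime

PSet : Set₁
PSet = P → Set

record IsUltrafilter (D : PSet → Set) : Set₁ where
  field
    upward : ∀ (A B : PSet) → (∀ p → A p → B p) → D A → D B
    inter  : ∀ (A B : PSet) → D A → D B → D (λ p → A p × B p)
    full   : D (λ _ → ⊤)
    proper : ¬ D (λ _ → ⊥)
    ultra  : ∀ (A : PSet) → D A ⊎ D (λ p → ¬ A p)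

NonPrincipal : (PSet → Set) → Set
NonPrincipal D = ∀ (q : P) → ¬ D (λ p → proj₁ p ≡ proj₁ q)

module Ultrapower (D : PSet → Set) where

  -- Representatives of elements of *ℤ = ℤ^P / D
  *ℤ : Set
  *ℤ = P → ℤ

  _≈_ : *ℤ → *ℤ → Set
  x ≈ y = D (λ p → x p ≡ y p)

  _≤*_ : *ℤ → *ℤ → Set
  x ≤* y = D (λ p → x p ℤ.≤ y p)

  _<*_ : *ℤ → *ℤ → Set
  x <* y = D (λ p → x p ℤ.< y p)

  _+*_ : *ℤ → *ℤ → *ℤ
  (x +* y) p = x p ℤ.+ y p

  _·*_ : *ℤ → *ℤ → *ℤ
  (x ·* y) p = x p ℤ.* y p

  -* : *ℤ → *ℤ
  -* x p = ℤ.- x p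

  embℤ : ℤ → *ℤ
  embℤ z _ = z

  embℕ : ℕ → *ℤ
  embℕ n = embℤ (+ n)

  0* 1* : *ℤ
  0* = embℤ (+ 0)
  1* = embℤ (+ 1)

  _∣*_ : *ℤ → *ℤ → Set
  a ∣* b = ∃[ c ] ((a ·* c) ≈ b)

  IsPrime* : *ℤ → Set
  IsPrime* q = ¬ (q ≈ 0*) × ¬ (q ∣* 1*)
             × (∀ a b → q ∣* (a ·* b) → (q ∣* a) ⊎ (q ∣* b))

-- First-order language of rings with constants 𝔭, ε, 𝐢.
-- Variables are de Bruijn indices into Fin n.
data Term (n : ℕ) : Set where
  var   : Fin n → Term n
  zeroᵗ : Term n
  oneᵗ  : Term n
  𝔭ᵗ    : Term n
  εᵗ    : Term n
  𝐢ᵗ    : Term n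
  _⊕_   : Term n → Term n → Term n
  _⊗_   : Term n → Term n → Term n
  ⊖_    : Term n → Term n

data Formula : ℕ → Set where
  _≐_   : ∀ {n} → Term n → Term n → Formula n
  ⊥ᶠ    : ∀ {n} → Formula n
  ¬ᶠ_   : ∀ {n} → Formula n → Formula n
  _∧ᶠ_  : ∀ {n} → Formula n → Formula n → Formula n
  _∨ᶠ_  : ∀ {n} → Formula n → Formula n → Formula n
  _⇒ᶠ_  : ∀ {n} → Formula n → Formula n → Formula n
  ∀ᶠ    : ∀ {n} → Formula (ℕ.suc n) → Formula n
  ∃ᶠ    : ∀ {n} → Formula (ℕ.suc n) → Formula n

_∷ᵉ_ : ∀ {A : Set} {n} → A → (Fin n → A) → Fin (ℕ.suc n) → A
(a ∷ᵉ ρ) zero    = a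
(a ∷ᵉ ρ) (suc i) = ρ i

module Semantics (D : PSet → Set) (𝔭 ε 𝐢 : Ultrapower.*ℤ D) where
  open Ultrapower D

  ⟦_⟧ᵗ : ∀ {n} → Term n → (Fin n → *ℤ) → *ℤ
  ⟦ var i ⟧ᵗ ρ = ρ i
  ⟦ zeroᵗ ⟧ᵗ ρ = 0*
  ⟦ oneᵗ ⟧ᵗ ρ = 1*
  ⟦ 𝔭ᵗ ⟧ᵗ ρ = 𝔭
  ⟦ εᵗ ⟧ᵗ ρ = ε
  ⟦ 𝐢ᵗ ⟧ᵗ ρ = 𝐢
  ⟦ s ⊕ t ⟧ᵗ ρ = ⟦ s ⟧ᵗ ρ +* ⟦ t ⟧ᵗ ρ
  ⟦ s ⊗ t ⟧ᵗ ρ = ⟦ s ⟧ᵗ ρ ·* ⟦ t ⟧ᵗ ρ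
  ⟦ ⊖ t ⟧ᵗ ρ = -* (⟦ t ⟧ᵗ ρ)

  _⊨_ : ∀ {n} → (Fin n → *ℤ) → Formula n → Set
  ρ ⊨ (s ≐ t) = ⟦ s ⟧ᵗ ρ ≈ ⟦ t ⟧ᵗ ρ
  ρ ⊨ ⊥ᶠ = ⊥
  ρ ⊨ (¬ᶠ φ) = ¬ (ρ ⊨ φ)
  ρ ⊨ (φ ∧ᶠ ψ) = (ρ ⊨ φ) × (ρ ⊨ ψ)
  ρ ⊨ (φ ∨ᶠ ψ) = (ρ ⊨ φ) ⊎ (ρ ⊨ ψ)
  ρ ⊨ (φ ⇒ᶠ ψ) = (ρ ⊨ φ) → (ρ ⊨ ψ)
  ρ ⊨ ∀ᶠ φ = ∀ (a : *ℤ) → (a ∷ᵉ ρ) ⊨ φ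
  ρ ⊨ ∃ᶠ φ = Σ *ℤ (λ a → (a ∷ᵉ ρ) ⊨ φ)

  FiniteGeneric : ∀ {k} → (Fin k → *ℤ) → Set
  FiniteGeneric {k} L =
    ∀ (Φ : Formula k) → (∀ (l : Fin k → ℕ) → (λ i → embℕ (l i)) ⊨ Φ) → L ⊨ Φ

  -- f : *ℤ^k → *ℤ is definable (without parameters): some formula θ(x̄, y)
  -- (y = variable zero, x_i = variable suc i) defines its graph.
  Definable : ∀ {k} → ((Fin k → *ℤ) → *ℤ) → Set
  Definable {k} f = Σ (Formula (ℕ.suc k)) λ θ →
    ∀ (x : Fin k → *ℤ) (y : *ℤ) → ((y ∷ᵉ x) ⊨ θ → f x ≈ y) × (f x ≈ y → (y ∷ᵉ x) ⊨ θ)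

-- Genericity passes to f(L): if θ defines the graph of f, then for every formula Φ(y) the
-- formula ∀y (θ(x̄, y) → Φ(y)) holds at every standard tuple, because f sends standard tuples
-- to natural numbers; hence it holds at L, where it says Φ(f(L)). Non-negativity is the case
-- where Φ(y) says that y is a sum of four squares: by Lagrange's theorem this holds at every
-- natural number, and it forces y ≥ 0 in almost every coordinate.
--
-- Lagrange's theorem is proved with the quaternion norm ‖x‖ = a² + b² + c² + d², which is
-- multiplicative (Euler's identity ‖x̄y‖ = ‖x‖‖y‖), so it suffices to treat a prime p. By
-- pigeonhole p divides some a² + b² + 1 with a, b ≤ p/2, so mp is a norm for some 0 < m < p.
-- Descent: write mp = ‖x‖ and x = y + mk with the components of y in (-m/2, m/2]. Then
-- ‖y‖ = mr with r ≤ m; r = 0 and r = m would force m ∣ p, and otherwise z = r + k̄y satisfies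
-- m²‖z‖ = ‖x̄y‖ = m²rp, so rp is a norm with 0 < r < m.

module Submission where

open import Algebra.Bundles.Raw using (RawRing)

-- Declared before the integer imports, whose _+_ and _*_ would clash with those of R.
module Quaternion {r ℓ} (R : RawRing r ℓ) where
  open RawRing R

  infixl 6 _⊞_
  infixl 7 _•_ _ᶜ*_

  record ℍ : Set r where
    constructor ⟨_,_,_,_⟩
    field re i j k : Carrier

  private
    infixl 6 _-′_
    _-′_ : Carrier → Carrier → Carrier
    x -′ y = x + - y

  real : Carrier → ℍ
  real a = ⟨ a , 0# , 0# , 0# ⟩

  _⊞_ : ℍ → ℍ → ℍ
  ⟨ a , b , c , d ⟩ ⊞ ⟨ e , f , g , h ⟩ = ⟨ a + e , b + f , c + g , d + h ⟩

  _•_ : Carrier → ℍ → ℍ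
  s • ⟨ a , b , c , d ⟩ = ⟨ s * a , s * b , s * c , s * d ⟩

  ⟪_,_⟫ : ℍ → ℍ → Carrier
  ⟪ ⟨ a , b , c , d ⟩ , ⟨ e , f , g , h ⟩ ⟫ = a * e + b * f + c * g + d * h

  ‖_‖ : ℍ → Carrier
  ‖ x ‖ = ⟪ x , x ⟫

  -- x̄y, where x̄ is the conjugate of x = a + bi + cj + dk
  _ᶜ*_ : ℍ → ℍ → ℍ
  ⟨ a , b , c , d ⟩ ᶜ* ⟨ e , f , g , h ⟩ =
    ⟨ a * e + b * f + c * g + d * h
    , a * f -′ b * e -′ c * h + d * g
    , a * g + b * h -′ c * e -′ d * f
    , a * h -′ b * g + c * f -′ d * e ⟩

open import Defs
open import Data.Empty using (⊥; ⊥-elim)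
open import Data.Fin as Fin using (Fin; zero; suc; #_; lift; toℕ; splitAt; join)
import Data.Fin.Properties as Finₚ
open import Data.Integer as ℤ
  using (ℤ; +_; -[1+_]; ∣_∣; 0ℤ; 1ℤ; _+_; _*_; _-_; -_; _<_; _≤_; +≤+; +<+)
open import Data.Integer.DivMod using (_%ℕ_; _/ℕ_; a≡a%ℕn+[a/ℕn]*n; n%ℕd<d)
import Data.Integer.Properties as ℤₚ
open import Data.Integer.Tactic.RingSolver using (ring; solve-∀)
open import Data.List.Relation.Unary.All using (All; []; _∷_)
open import Data.Nat as ℕ using (ℕ; zero; suc; z≤n; s≤s; ⌊_/2⌋; ⌈_/2⌉)
open import Data.Nat.Divisibility using (_∣_; divides; >⇒∤)
open import Data.Nat.Induction using (<-rec)
open import Data.Nat.ListAction using (product)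
open import Data.Nat.Primality
  using (Prime; prime⇒irreducible; prime⇒nonZero; prime⇒nonTrivial; euclidsLemma)
open import Data.Nat.Primality.Factorisation using (factorise; PrimeFactorisation)
import Data.Nat.Properties as ℕₚ
open import Data.Product using (Σ; ∃; ∃₂; _×_; _,_; proj₁; proj₂)
open import Data.Product.Function.NonDependent.Propositional using (_×-⇔_)
open import Data.Sum using (_⊎_; inj₁; inj₂; [_,_]′)
import Data.Sum as Sum
open import Data.Sum.Function.Propositional using (_⊎-⇔_)
open import Function.Bundles using (_⇔_; mk⇔; module Equivalence)
open import Function.Related.TypeIsomorphisms using (→-cong-⇔; ¬-cong-⇔)
open import Relation.Binary.Definitions using (tri<; tri≈; tri>)
open import Relation.Binary.PropositionalEquality
  using (_≡_; _≢_; refl; sym; trans; cong; cong₂; subst; module ≡-Reasoning)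
open import Relation.Nullary using (¬_; Dec; yes; no)
open import Tactic.RingSolver.NonReflective ring
  using (Expr; Κ; ⊝_; _⊜_; solve) renaming (_⊕_ to _+ₑ_; _⊗_ to _*ₑ_)

open Equivalence using (to; from)

-- Identities between quaternion expressions are proved by instantiating the quaternion
-- operations in the ring solver's syntax and normalising.
exprRing : ℕ → RawRing _ _
exprRing n = record
  { Carrier = Expr ℤ n ; _≈_ = _≡_ ; _+_ = _+ₑ_ ; _*_ = _*ₑ_ ; -_ = ⊝_ ; 0# = Κ 0ℤ ; 1# = Κ 1ℤ }

open Quaternion ℤ.+-*-rawRing

norm-ᶜ* : ∀ x y → ‖ x ᶜ* y ‖ ≡ ‖ x ‖ * ‖ y ‖
norm-ᶜ* ⟨ a , b , c , d ⟩ ⟨ e , f , g , h ⟩ =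
  solve 8 (λ a b c d e f g h → let x = ⟨ a , b , c , d ⟩ ; y = ⟨ e , f , g , h ⟩ in
    E.‖ x E.ᶜ* y ‖ ⊜ E.‖ x ‖ *ₑ E.‖ y ‖) refl a b c d e f g h
  where module E = Quaternion (exprRing 8)
        open E using (⟨_,_,_,_⟩)

norm-⊞• : ∀ y m k → ‖ y ⊞ m • k ‖ ≡ ‖ y ‖ + m * ⟪ k , y ⊞ y ⊞ m • k ⟫
norm-⊞• ⟨ a , b , c , d ⟩ m ⟨ e , f , g , h ⟩ =
  solve 9 (λ a b c d m e f g h → let y = ⟨ a , b , c , d ⟩ ; k = ⟨ e , f , g , h ⟩ in
    E.‖ y E.⊞ m E.• k ‖ ⊜ (E.‖ y ‖ +ₑ m *ₑ E.⟪ k , y E.⊞ y E.⊞ m E.• k ⟫)) refl a b c d m e f g h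
  where module E = Quaternion (exprRing 9)
        open E using (⟨_,_,_,_⟩)

norm-⊞•-ᶜ* : ∀ y m k → ‖ (y ⊞ m • k) ᶜ* y ‖ ≡ ‖ real ‖ y ‖ ⊞ m • (k ᶜ* y) ‖
norm-⊞•-ᶜ* ⟨ a , b , c , d ⟩ m ⟨ e , f , g , h ⟩ =
  solve 9 (λ a b c d m e f g h → let y = ⟨ a , b , c , d ⟩ ; k = ⟨ e , f , g , h ⟩ in
    E.‖ (y E.⊞ m E.• k) E.ᶜ* y ‖ ⊜ E.‖ E.real E.‖ y ‖ E.⊞ m E.• (k E.ᶜ* y) ‖) refl a b c d m e f g h
  where module E = Quaternion (exprRing 9)
        open E using (⟨_,_,_,_⟩)

norm-real*-⊞• : ∀ m r w → ‖ real (m * r) ⊞ m • w ‖ ≡ m * (m * ‖ real r ⊞ w ‖)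
norm-real*-⊞• m r ⟨ a , b , c , d ⟩ =
  solve 6 (λ m r a b c d → let w = ⟨ a , b , c , d ⟩ in
    E.‖ E.real (m *ₑ r) E.⊞ m E.• w ‖ ⊜ m *ₑ (m *ₑ E.‖ E.real r E.⊞ w ‖)) refl m r a b c d
  where module E = Quaternion (exprRing 6)
        open E using (⟨_,_,_,_⟩)

norm-0⊞• : ∀ m k → ‖ real 0ℤ ⊞ m • k ‖ ≡ m * (m * ‖ k ‖)
norm-0⊞• m ⟨ a , b , c , d ⟩ =
  solve 5 (λ m a b c d → let k = ⟨ a , b , c , d ⟩ in
    E.‖ E.real (Κ 0ℤ) E.⊞ m E.• k ‖ ⊜ m *ₑ (m *ₑ E.‖ k ‖)) refl m a b c d
  where module E = Quaternion (exprRing 5)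
        open E using (⟨_,_,_,_⟩)

norm-diag⊞• : ∀ c k → ‖ ⟨ c , c , c , c ⟩ ⊞ (c + c) • k ‖
                      ≡ (c + c) * ((c + c) * (1ℤ + ⟪ k , k ⊞ ⟨ 1ℤ , 1ℤ , 1ℤ , 1ℤ ⟩ ⟫))
norm-diag⊞• c ⟨ a , b , d , e ⟩ =
  solve 5 (λ c a b d e → let k = ⟨ a , b , d , e ⟩ ; 1ₑ = Κ 1ℤ in
    E.‖ ⟨ c , c , c , c ⟩ E.⊞ (c +ₑ c) E.• k ‖
      ⊜ (c +ₑ c) *ₑ ((c +ₑ c) *ₑ (1ₑ +ₑ E.⟪ k , k E.⊞ ⟨ 1ₑ , 1ₑ , 1ₑ , 1ₑ ⟩ ⟫))) refl c a b d e
  where module E = Quaternion (exprRing 5)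
        open E using (⟨_,_,_,_⟩)

norm-⊞-self : ∀ y → ‖ y ⊞ y ‖ ≡ + 4 * ‖ y ‖
norm-⊞-self ⟨ a , b , c , d ⟩ =
  solve 4 (λ a b c d → let y = ⟨ a , b , c , d ⟩ in
    E.‖ y E.⊞ y ‖ ⊜ Κ (+ 4) *ₑ E.‖ y ‖) refl a b c d
  where module E = Quaternion (exprRing 4)
        open E using (⟨_,_,_,_⟩)

i*i≡∣i∣*∣i∣ : ∀ i → i * i ≡ + (∣ i ∣ ℕ.* ∣ i ∣)
i*i≡∣i∣*∣i∣ (+ n)    = sym (ℤₚ.pos-* n n)
i*i≡∣i∣*∣i∣ -[1+ n ] = refl

normℕ : ℍ → ℕ
normℕ ⟨ a , b , c , d ⟩ = ∣ a ∣ ℕ.* ∣ a ∣ ℕ.+ ∣ b ∣ ℕ.* ∣ b ∣ ℕ.+ ∣ c ∣ ℕ.* ∣ c ∣ ℕ.+ ∣ d ∣ ℕ.* ∣ d ∣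

norm≡normℕ : ∀ x → ‖ x ‖ ≡ + normℕ x
norm≡normℕ ⟨ a , b , c , d ⟩ =
  cong₂ _+_ (cong₂ _+_ (cong₂ _+_ (i*i≡∣i∣*∣i∣ a) (i*i≡∣i∣*∣i∣ b)) (i*i≡∣i∣*∣i∣ c)) (i*i≡∣i∣*∣i∣ d)

sum4≡0 : ∀ a b c d → a ℕ.+ b ℕ.+ c ℕ.+ d ≡ 0 → a ≡ 0 × b ≡ 0 × c ≡ 0 × d ≡ 0
sum4≡0 a b c d eq =
  ℕₚ.m+n≡0⇒m≡0 a abc≡0 , ℕₚ.m+n≡0⇒n≡0 a abc≡0 , ℕₚ.m+n≡0⇒n≡0 (a ℕ.+ b) ab+c≡0 , ℕₚ.m+n≡0⇒n≡0 _ eq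
  where
  ab+c≡0 : a ℕ.+ b ℕ.+ c ≡ 0
  ab+c≡0 = ℕₚ.m+n≡0⇒m≡0 _ eq
  abc≡0 : a ℕ.+ b ≡ 0
  abc≡0 = ℕₚ.m+n≡0⇒m≡0 _ ab+c≡0

⟨⟩-cong : ∀ {a b c d a′ b′ c′ d′} → a ≡ a′ → b ≡ b′ → c ≡ c′ → d ≡ d′ →
          ⟨ a , b , c , d ⟩ ≡ ⟨ a′ , b′ , c′ , d′ ⟩
⟨⟩-cong refl refl refl refl = refl

∣i∣*∣i∣≡0⇒i≡0 : ∀ i → ∣ i ∣ ℕ.* ∣ i ∣ ≡ 0 → i ≡ 0ℤ
∣i∣*∣i∣≡0⇒i≡0 i eq = ℤₚ.∣i∣≡0⇒i≡0 (Sum.reduce (ℕₚ.m*n≡0⇒m≡0∨n≡0 ∣ i ∣ eq))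

norm≡0⇒≡0 : ∀ x → ‖ x ‖ ≡ 0ℤ → x ≡ real 0ℤ
norm≡0⇒≡0 x@(⟨ a , b , c , d ⟩) ‖x‖≡0 =
  let a≡0 , b≡0 , c≡0 , d≡0 = sum4≡0 _ _ _ _ (ℤₚ.+-injective (trans (sym (norm≡normℕ x)) ‖x‖≡0))
  in  ⟨⟩-cong (∣i∣*∣i∣≡0⇒i≡0 a a≡0) (∣i∣*∣i∣≡0⇒i≡0 b b≡0) (∣i∣*∣i∣≡0⇒i≡0 c c≡0) (∣i∣*∣i∣≡0⇒i≡0 d d≡0)

FourSquares : ℕ → Set
FourSquares n = Σ ℍ λ x → ‖ x ‖ ≡ + n

fourSquares-* : ∀ {m n} → FourSquares m → FourSquares n → FourSquares (m ℕ.* n)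
fourSquares-* {m} {n} (x , ‖x‖≡m) (y , ‖y‖≡n) =
  x ᶜ* y , trans (norm-ᶜ* x y) (trans (cong₂ _*_ ‖x‖≡m ‖y‖≡n) (sym (ℤₚ.pos-* m n)))

m*q≡n⇒q≡+∣q∣ : ∀ {m q n} → 0 ℕ.< m → + m * q ≡ + n → q ≡ + ∣ q ∣
m*q≡n⇒q≡+∣q∣ {suc m} {+ q}      _ _  = refl
m*q≡n⇒q≡+∣q∣ {suc m} { -[1+ q ]} _ ()

Balanced : ℕ → ℤ → Set
Balanced m y = - + m < y + y × y + y ≤ + m

balanced-residue : ∀ m .{{_ : ℕ.NonZero m}} x → ∃₂ λ y k → x ≡ y + + m * k × Balanced m y
balanced-residue m x = choose (r ℕ.+ r ℕ.≤? m)
  where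
  r : ℕ
  r = x %ℕ m
  q : ℤ
  q = x /ℕ m
  x≡r+mq : x ≡ + r + + m * q
  x≡r+mq = trans (a≡a%ℕn+[a/ℕn]*n x m) (cong (_+_ (+ r)) (ℤₚ.*-comm q (+ m)))
  choose : Dec (r ℕ.+ r ℕ.≤ m) → ∃₂ λ y k → x ≡ y + + m * k × Balanced m y
  choose (yes 2r≤m) = + r , q , x≡r+mq , ℤₚ.<-≤-trans -m<0 (+≤+ z≤n) , +≤+ 2r≤m
    where
    -m<0 : - + m < 0ℤ
    -m<0 = ℤₚ.neg-mono-< (+<+ (ℕ.>-nonZero⁻¹ m))
  choose (no 2r≰m) = + r - + m , q + 1ℤ , trans x≡r+mq (shift (+ r) q (+ m)) , -m<2y , 2y≤m
    where
    shift : ∀ r q m → r + m * q ≡ (r - m) + m * (q + 1ℤ)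
    shift = solve-∀
    y≤0 : + r - + m ≤ 0ℤ
    y≤0 = ℤₚ.i≤j⇒i-j≤0 (+≤+ (ℕₚ.<⇒≤ (n%ℕd<d x m)))
    2y≤m : (+ r - + m) + (+ r - + m) ≤ + m
    2y≤m = ℤₚ.≤-trans (ℤₚ.+-mono-≤ y≤0 y≤0) (+≤+ z≤n)
    -m<2y : - + m < (+ r - + m) + (+ r - + m)
    -m<2y = begin-strict
      - + m                            ≡⟨ left (+ m) ⟩
      + m + (- + m - + m)              <⟨ ℤₚ.+-monoˡ-< (- + m - + m) (+<+ (ℕₚ.≰⇒> 2r≰m)) ⟩
      + (r ℕ.+ r) + (- + m - + m)      ≡⟨ right (+ r) (+ m) ⟩
      (+ r - + m) + (+ r - + m)        ∎
      where
      open ℤₚ.≤-Reasoning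
      left : ∀ m → - m ≡ m + (- m - m)
      left = solve-∀
      right : ∀ r m → (r + r) + (- m - m) ≡ (r - m) + (r - m)
      right = solve-∀

+-self-injective : ∀ {a b} → a + a ≡ b + b → a ≡ b
+-self-injective {a} {b} eq = ℤₚ.*-cancelˡ-≡ (+ 2) a b (trans (double a) (trans eq (sym (double b))))
  where
  double : ∀ a → + 2 * a ≡ a + a
  double = solve-∀

0<m+t : ∀ {m t} → - m < t → 0ℤ < m + t
0<m+t {m} {t} -m<t = subst (_< m + t) (ℤₚ.+-inverseʳ m) (ℤₚ.+-monoʳ-< m -m<t)

-- (m - t)(m + t) = m² - t², a natural number when -m < t ≤ m
gap : ℤ → ℤ → ℕ
gap m t = ∣ m - t ∣ ℕ.* ∣ m + t ∣

square+gap : ∀ {m t} → - m < t → t ≤ m → t * t + + gap m t ≡ m * m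
square+gap {m} {t} -m<t t≤m = begin
  t * t + + (∣ m - t ∣ ℕ.* ∣ m + t ∣)  ≡⟨ cong (_+_ (t * t)) (ℤₚ.pos-* ∣ m - t ∣ ∣ m + t ∣) ⟩
  t * t + + ∣ m - t ∣ * + ∣ m + t ∣    ≡⟨ cong (_+_ (t * t)) (cong₂ _*_ (ℤₚ.0≤i⇒+∣i∣≡i (ℤₚ.i≤j⇒0≤j-i t≤m))
                                                                   (ℤₚ.0≤i⇒+∣i∣≡i (ℤₚ.<⇒≤ (0<m+t -m<t)))) ⟩
  t * t + (m - t) * (m + t)            ≡⟨ difference-of-squares t m ⟩
  m * m                                ∎
  where
  open ≡-Reasoning
  difference-of-squares : ∀ t m → t * t + (m - t) * (m + t) ≡ m * m
  difference-of-squares = solve-∀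

gap≡0⇒≡ : ∀ {m t} → - m < t → gap m t ≡ 0 → t ≡ m
gap≡0⇒≡ {m} {t} -m<t g≡0 with ℕₚ.m*n≡0⇒m≡0∨n≡0 ∣ m - t ∣ g≡0
... | inj₁ ∣m-t∣≡0 = sym (ℤₚ.i-j≡0⇒i≡j m t (ℤₚ.∣i∣≡0⇒i≡0 ∣m-t∣≡0))
... | inj₂ ∣m+t∣≡0 = ⊥-elim (ℤₚ.<⇒≢ (0<m+t -m<t) (sym (ℤₚ.∣i∣≡0⇒i≡0 ∣m+t∣≡0)))

Balancedℍ : ℕ → ℍ → Set
Balancedℍ m ⟨ a , b , c , d ⟩ = Balanced m a × Balanced m b × Balanced m c × Balanced m d

balanced-residueℍ : ∀ m .{{_ : ℕ.NonZero m}} x → ∃₂ λ y k → x ≡ y ⊞ + m • k × Balancedℍ m y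
balanced-residueℍ m ⟨ a , b , c , d ⟩ =
  let ya , ka , a≡ , Ba = balanced-residue m a
      yb , kb , b≡ , Bb = balanced-residue m b
      yc , kc , c≡ , Bc = balanced-residue m c
      yd , kd , d≡ , Bd = balanced-residue m d
  in  ⟨ ya , yb , yc , yd ⟩ , ⟨ ka , kb , kc , kd ⟩ , ⟨⟩-cong a≡ b≡ c≡ d≡ , Ba , Bb , Bc , Bd

Gap : ℕ → ℍ → ℕ
Gap m ⟨ a , b , c , d ⟩ = gap (+ m) (a + a) ℕ.+ gap (+ m) (b + b) ℕ.+ gap (+ m) (c + c) ℕ.+ gap (+ m) (d + d)

norm-⊞-self+Gap : ∀ {m} y → Balancedℍ m y → ‖ y ⊞ y ‖ + + Gap m y ≡ + 4 * (+ m * + m)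
norm-⊞-self+Gap {m} ⟨ a , b , c , d ⟩ ((a₁ , a₂) , (b₁ , b₂) , (c₁ , c₂) , (d₁ , d₂)) = begin
  ‖ ⟨ a + a , b + b , c + c , d + d ⟩ ‖ + + Gap m ⟨ a , b , c , d ⟩
    ≡⟨ regroup (a + a) (b + b) (c + c) (d + d)
               (+ gap M (a + a)) (+ gap M (b + b)) (+ gap M (c + c)) (+ gap M (d + d)) ⟩
  ((a + a) * (a + a) + + gap M (a + a)) + ((b + b) * (b + b) + + gap M (b + b))
    + ((c + c) * (c + c) + + gap M (c + c)) + ((d + d) * (d + d) + + gap M (d + d))
    ≡⟨ cong₂ _+_ (cong₂ _+_ (cong₂ _+_ (square+gap a₁ a₂) (square+gap b₁ b₂)) (square+gap c₁ c₂))
                 (square+gap d₁ d₂) ⟩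
  M * M + M * M + M * M + M * M
    ≡⟨ four (M * M) ⟩
  + 4 * (M * M) ∎
  where
  M : ℤ
  M = + m
  open ≡-Reasoning
  regroup : ∀ s t u v g h i j → s * s + t * t + u * u + v * v + (g + h + i + j)
                               ≡ (s * s + g) + (t * t + h) + (u * u + i) + (v * v + j)
  regroup = solve-∀
  four : ∀ x → x + x + x + x ≡ + 4 * x
  four = solve-∀

Gap≡0⇒ : ∀ {m} y → Balancedℍ m y → Gap m y ≡ 0 → y ⊞ y ≡ ⟨ + m , + m , + m , + m ⟩
Gap≡0⇒ ⟨ a , b , c , d ⟩ ((a₁ , _) , (b₁ , _) , (c₁ , _) , (d₁ , _)) G≡0 =
  let ga≡0 , gb≡0 , gc≡0 , gd≡0 = sum4≡0 _ _ _ _ G≡0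
  in  ⟨⟩-cong (gap≡0⇒≡ a₁ ga≡0) (gap≡0⇒≡ b₁ gb≡0) (gap≡0⇒≡ c₁ gc≡0) (gap≡0⇒≡ d₁ gd≡0)

balanced-norm-gap : ∀ {m r} y → Balancedℍ m y → ‖ y ‖ ≡ + m * + r →
                    4 ℕ.* (m ℕ.* r) ℕ.+ Gap m y ≡ 4 ℕ.* (m ℕ.* m)
balanced-norm-gap {m} {r} y balanced ‖y‖≡mr = ℤₚ.+-injective (begin
  + (4 ℕ.* (m ℕ.* r) ℕ.+ Gap m y)  ≡⟨ cong (_+ + Gap m y) (pos-4*m*n m r) ⟩
  + 4 * (+ m * + r) + + Gap m y    ≡⟨ cong (λ s → + 4 * s + + Gap m y) ‖y‖≡mr ⟨
  + 4 * ‖ y ‖ + + Gap m y          ≡⟨ cong (_+ + Gap m y) (norm-⊞-self y) ⟨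
  ‖ y ⊞ y ‖ + + Gap m y            ≡⟨ norm-⊞-self+Gap y balanced ⟩
  + 4 * (+ m * + m)                ≡⟨ pos-4*m*n m m ⟨
  + (4 ℕ.* (m ℕ.* m))              ∎)
  where
  open ≡-Reasoning
  pos-4*m*n : ∀ m n → + (4 ℕ.* (m ℕ.* n)) ≡ + 4 * (+ m * + n)
  pos-4*m*n m n = trans (ℤₚ.pos-* 4 (m ℕ.* n)) (cong (+ 4 *_) (ℤₚ.pos-* m n))

balanced-norm-≤ : ∀ {m r} .{{_ : ℕ.NonZero m}} y → Balancedℍ m y → ‖ y ‖ ≡ + m * + r → r ℕ.≤ m
balanced-norm-≤ {m} {r} y balanced ‖y‖≡mr =
  ℕₚ.*-cancelˡ-≤ m (ℕₚ.*-cancelˡ-≤ 4 (subst (4 ℕ.* (m ℕ.* r) ℕ.≤_) (balanced-norm-gap y balanced ‖y‖≡mr)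
                                              (ℕₚ.m≤m+n _ (Gap m y))))

balanced-norm-max : ∀ {m} y → Balancedℍ m y → ‖ y ‖ ≡ + m * + m → ∃ λ c → y ≡ ⟨ c , c , c , c ⟩ × c + c ≡ + m
balanced-norm-max {m} y@(⟨ a , b , c , d ⟩) balanced ‖y‖≡mm =
  a , ⟨⟩-cong refl (same (cong ℍ.i 2y≡m)) (same (cong ℍ.j 2y≡m)) (same (cong ℍ.k 2y≡m)) , a+a≡m
  where
  2y≡m : y ⊞ y ≡ ⟨ + m , + m , + m , + m ⟩
  2y≡m = Gap≡0⇒ y balanced (ℕₚ.+-cancelˡ-≡ _ (Gap m y) 0
                              (trans (balanced-norm-gap y balanced ‖y‖≡mm) (sym (ℕₚ.+-identityʳ _))))
  a+a≡m : a + a ≡ + m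
  a+a≡m = cong ℍ.re 2y≡m
  same : ∀ {e} → e + e ≡ + m → e ≡ a
  same e+e≡m = +-self-injective (trans e+e≡m (sym a+a≡m))

1<m<p⇒m∤p : ∀ {p m} → Prime p → 1 ℕ.< m → m ℕ.< p → ¬ m ∣ p
1<m<p⇒m∤p p-prime 1<m m<p m∣p with prime⇒irreducible p-prime m∣p
... | inj₁ refl = ℕₚ.<-irrefl refl 1<m
... | inj₂ refl = ℕₚ.<-irrefl refl m<p

m*p≢m*[m*c] : ∀ {p m} → Prime p → 1 ℕ.< m → m ℕ.< p → ∀ c → + m * + p ≢ + m * (+ m * c)
m*p≢m*[m*c] {p} {m} p-prime 1<m m<p c eq = 1<m<p⇒m∤p p-prime 1<m m<p (divides ∣ c ∣ p≡∣c∣*m)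
  where
  instance
    m≢0 : ℕ.NonZero m
    m≢0 = ℕ.>-nonZero (ℕₚ.<-trans (s≤s z≤n) 1<m)
  p≡∣c∣*m : p ≡ ∣ c ∣ ℕ.* m
  p≡∣c∣*m = trans (cong ∣_∣ (ℤₚ.*-cancelˡ-≡ (+ m) (+ p) (+ m * c) eq))
                  (trans (ℤₚ.abs-* (+ m) c) (ℕₚ.*-comm m ∣ c ∣))

norm-residue≡m*r : ∀ {m p} → 0 ℕ.< m → ∀ y k → ‖ y ⊞ + m • k ‖ ≡ + m * + p → ∃ λ r → ‖ y ‖ ≡ + m * + r
norm-residue≡m*r {m} {p} 0<m y k ‖x‖≡mp =
  ∣ q ∣ , trans ‖y‖≡mq (cong (+ m *_) (m*q≡n⇒q≡+∣q∣ 0<m (trans (sym ‖y‖≡mq) (norm≡normℕ y))))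
  where
  q : ℤ
  q = + p - ⟪ k , y ⊞ y ⊞ + m • k ⟫
  ‖y‖≡mq : ‖ y ‖ ≡ + m * q
  ‖y‖≡mq = isolate ‖ y ‖ (+ m) (+ p) ⟪ k , y ⊞ y ⊞ + m • k ⟫ (trans (sym (norm-⊞• y (+ m) k)) ‖x‖≡mp)
    where
    isolate : ∀ s m p c → s + m * c ≡ m * p → s ≡ m * (p - c)
    isolate s m p c eq = begin
      s                  ≡⟨ cancel s (m * c) ⟩
      s + m * c - m * c  ≡⟨ cong (_- m * c) eq ⟩
      m * p - m * c      ≡⟨ factor m p c ⟩
      m * (p - c)        ∎
      where
      open ≡-Reasoning
      cancel : ∀ a b → a ≡ a + b - b
      cancel = solve-∀
      factor : ∀ m p c → m * p - m * c ≡ m * (p - c)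
      factor = solve-∀

descent-step : ∀ {m p r} .{{_ : ℕ.NonZero m}} y k →
               ‖ y ⊞ + m • k ‖ ≡ + m * + p → ‖ y ‖ ≡ + m * + r → FourSquares (r ℕ.* p)
descent-step {m} {p} {r} y k ‖x‖≡mp ‖y‖≡mr =
  z , ℤₚ.*-cancelˡ-≡ (+ m) _ _ (ℤₚ.*-cancelˡ-≡ (+ m) _ _ m*m*‖z‖≡m*m*rp)
  where
  z : ℍ
  z = real (+ r) ⊞ k ᶜ* y
  m*m*‖z‖≡m*m*rp : + m * (+ m * ‖ z ‖) ≡ + m * (+ m * + (r ℕ.* p))
  m*m*‖z‖≡m*m*rp = begin
    + m * (+ m * ‖ z ‖)                  ≡⟨ norm-real*-⊞• (+ m) (+ r) (k ᶜ* y) ⟨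
    ‖ real (+ m * + r) ⊞ + m • (k ᶜ* y) ‖ ≡⟨ cong (λ s → ‖ real s ⊞ + m • (k ᶜ* y) ‖) ‖y‖≡mr ⟨
    ‖ real ‖ y ‖ ⊞ + m • (k ᶜ* y) ‖       ≡⟨ norm-⊞•-ᶜ* y (+ m) k ⟨
    ‖ (y ⊞ + m • k) ᶜ* y ‖                ≡⟨ norm-ᶜ* (y ⊞ + m • k) y ⟩
    ‖ y ⊞ + m • k ‖ * ‖ y ‖               ≡⟨ cong₂ _*_ ‖x‖≡mp ‖y‖≡mr ⟩
    (+ m * + p) * (+ m * + r)             ≡⟨ regroup (+ m) (+ p) (+ r) ⟩
    + m * (+ m * (+ r * + p))             ≡⟨ cong (λ s → + m * (+ m * s)) (ℤₚ.pos-* r p) ⟨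
    + m * (+ m * + (r ℕ.* p))             ∎
    where
    open ≡-Reasoning
    regroup : ∀ m p r → (m * p) * (m * r) ≡ m * (m * (r * p))
    regroup = solve-∀

balanced-descent : ∀ {p m} .{{_ : ℕ.NonZero m}} → Prime p → 1 ℕ.< m → m ℕ.< p →
                   ∀ y k → Balancedℍ m y → ‖ y ⊞ + m • k ‖ ≡ + m * + p →
                   ∃ λ r → 0 ℕ.< r × r ℕ.< m × FourSquares (r ℕ.* p)
balanced-descent {p} {m} p-prime 1<m m<p y k balanced ‖y+mk‖≡mp =
  reduce (norm-residue≡m*r (ℕ.>-nonZero⁻¹ m) y k ‖y+mk‖≡mp)
  where
  open ≡-Reasoning
  impossible : ∀ c → ‖ y ⊞ + m • k ‖ ≡ + m * (+ m * c) → ⊥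
  impossible c eq = m*p≢m*[m*c] p-prime 1<m m<p c (trans (sym ‖y+mk‖≡mp) eq)
  zero-residue : ‖ y ‖ ≡ 0ℤ → ⊥
  zero-residue ‖y‖≡0 = impossible ‖ k ‖ (begin
    ‖ y ⊞ + m • k ‖          ≡⟨ cong (λ y → ‖ y ⊞ + m • k ‖) (norm≡0⇒≡0 y ‖y‖≡0) ⟩
    ‖ real 0ℤ ⊞ + m • k ‖    ≡⟨ norm-0⊞• (+ m) k ⟩
    + m * (+ m * ‖ k ‖)      ∎)
  half-residue : ‖ y ‖ ≡ + m * + m → ⊥
  half-residue ‖y‖≡mm =
    let c , y≡c , c+c≡m = balanced-norm-max y balanced ‖y‖≡mm
        C = 1ℤ + ⟪ k , k ⊞ ⟨ 1ℤ , 1ℤ , 1ℤ , 1ℤ ⟩ ⟫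
    in  impossible C (begin
          ‖ y ⊞ + m • k ‖                        ≡⟨ cong₂ (λ y s → ‖ y ⊞ s • k ‖) y≡c (sym c+c≡m) ⟩
          ‖ ⟨ c , c , c , c ⟩ ⊞ (c + c) • k ‖    ≡⟨ norm-diag⊞• c k ⟩
          (c + c) * ((c + c) * C)                ≡⟨ cong (λ s → s * (s * C)) c+c≡m ⟩
          + m * (+ m * C)                        ∎)
  reduce : (∃ λ r → ‖ y ‖ ≡ + m * + r) → ∃ λ r → 0 ℕ.< r × r ℕ.< m × FourSquares (r ℕ.* p)
  reduce (zero , ‖y‖≡0) = ⊥-elim (zero-residue (trans ‖y‖≡0 (ℤₚ.*-zeroʳ (+ m))))
  reduce (suc r , ‖y‖≡mr) =
    [ (λ r<m → suc r , s≤s z≤n , r<m , descent-step y k ‖y+mk‖≡mp ‖y‖≡mr)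
    , (λ r≡m → ⊥-elim (half-residue (subst (λ r → ‖ y ‖ ≡ + m * + r) r≡m ‖y‖≡mr)))
    ]′ (ℕₚ.m≤n⇒m<n∨m≡n (balanced-norm-≤ y balanced ‖y‖≡mr))

descent : ∀ {p m} → Prime p → 1 ℕ.< m → m ℕ.< p → FourSquares (m ℕ.* p) →
          ∃ λ r → 0 ℕ.< r × r ℕ.< m × FourSquares (r ℕ.* p)
descent {p} {m} p-prime 1<m m<p (x , ‖x‖≡mp) =
  let y , k , x≡y+mk , balanced = balanced-residueℍ m x
  in  balanced-descent p-prime 1<m m<p y k balanced
        (trans (cong ‖_‖ (sym x≡y+mk)) (trans ‖x‖≡mp (ℤₚ.pos-* m p)))
  where
  instance
    m≢0 : ℕ.NonZero m
    m≢0 = ℕ.>-nonZero (ℕₚ.<-trans (s≤s z≤n) 1<m)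

pigeonhole-⊎ : ∀ {m n k} → k ℕ.< m ℕ.+ n → (f : Fin m ⊎ Fin n → Fin k) → ∃₂ λ u v → u ≢ v × f u ≡ f v
pigeonhole-⊎ {m} {n} k<m+n f with Finₚ.pigeonhole k<m+n (λ i → f (splitAt m i))
... | i , j , i<j , fi≡fj = splitAt m i , splitAt m j , splitAt-injective , fi≡fj
  where
  splitAt-injective : splitAt m i ≢ splitAt m j
  splitAt-injective eq = Finₚ.<⇒≢ i<j
    (trans (sym (Finₚ.join-splitAt m n i)) (trans (cong (join m n) eq) (Finₚ.join-splitAt m n j)))

residueMod : ∀ p .{{_ : ℕ.NonZero p}} → ℤ → Fin p
residueMod p z = Fin.fromℕ< (n%ℕd<d z p)

residueMod-≡⇒∣ : ∀ {p} .{{_ : ℕ.NonZero p}} u v → residueMod p u ≡ residueMod p v → p ∣ ∣ u - v ∣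
residueMod-≡⇒∣ {p} u v eq = divides ∣ qu - qv ∣ (trans (cong ∣_∣ u-v≡) (ℤₚ.abs-* (qu - qv) (+ p)))
  where
  qu qv : ℤ
  qu = u /ℕ p
  qv = v /ℕ p
  r≡ : u %ℕ p ≡ v %ℕ p
  r≡ = trans (sym (Finₚ.toℕ-fromℕ< _)) (trans (cong toℕ eq) (Finₚ.toℕ-fromℕ< _))
  u-v≡ : u - v ≡ (qu - qv) * + p
  u-v≡ = begin
    u - v                                            ≡⟨ cong₂ _-_ (a≡a%ℕn+[a/ℕn]*n u p) (a≡a%ℕn+[a/ℕn]*n v p) ⟩
    (+ (u %ℕ p) + qu * + p) - (+ (v %ℕ p) + qv * + p) ≡⟨ cong (λ r → (+ r + qu * + p) - (+ (v %ℕ p) + qv * + p)) r≡ ⟩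
    (+ (v %ℕ p) + qu * + p) - (+ (v %ℕ p) + qv * + p) ≡⟨ cancel (+ (v %ℕ p)) qu qv (+ p) ⟩
    (qu - qv) * + p                                  ∎
    where
    open ≡-Reasoning
    cancel : ∀ r a b p → (r + a * p) - (r + b * p) ≡ (a - b) * p
    cancel = solve-∀

≢0∧<⇒∤ : ∀ {p n} → n ≢ 0 → n ℕ.< p → ¬ p ∣ n
≢0∧<⇒∤ n≢0 n<p = >⇒∤ {{ℕ.≢-nonZero n≢0}} n<p

prime∤a²-b² : ∀ {p a b} → Prime p → a ≢ b → a ℕ.+ b ℕ.< p → ¬ p ∣ ∣ + a * + a - + b * + b ∣
prime∤a²-b² {p} {a} {b} p-prime a≢b a+b<p p∣a²-b²
  with euclidsLemma ∣ + a - + b ∣ (a ℕ.+ b) p-prime (subst (p ∣_) ∣a²-b²∣≡ p∣a²-b²)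
  where
  ∣a²-b²∣≡ : ∣ + a * + a - + b * + b ∣ ≡ ∣ + a - + b ∣ ℕ.* (a ℕ.+ b)
  ∣a²-b²∣≡ = trans (cong ∣_∣ (difference-of-squares (+ a) (+ b))) (ℤₚ.abs-* (+ a - + b) (+ a + + b))
    where
    difference-of-squares : ∀ a b → a * a - b * b ≡ (a - b) * (a + b)
    difference-of-squares = solve-∀
... | inj₁ p∣a-b = ≢0∧<⇒∤ ∣a-b∣≢0 (ℕₚ.≤-<-trans (ℤₚ.∣i-j∣≤∣i∣+∣j∣ (+ a) (+ b)) a+b<p) p∣a-b
  where
  ∣a-b∣≢0 : ∣ + a - + b ∣ ≢ 0
  ∣a-b∣≢0 eq = a≢b (ℤₚ.+-injective (ℤₚ.i-j≡0⇒i≡j (+ a) (+ b) (ℤₚ.∣i∣≡0⇒i≡0 eq)))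
... | inj₂ p∣a+b = ≢0∧<⇒∤ a+b≢0 a+b<p p∣a+b
  where
  a+b≢0 : a ℕ.+ b ≢ 0
  a+b≢0 eq = a≢b (trans (ℕₚ.m+n≡0⇒m≡0 a eq) (sym (ℕₚ.m+n≡0⇒n≡0 a eq)))

⌈n/2⌉≤1+⌊n/2⌋ : ∀ n → ⌈ n /2⌉ ℕ.≤ suc ⌊ n /2⌋
⌈n/2⌉≤1+⌊n/2⌋ zero          = z≤n
⌈n/2⌉≤1+⌊n/2⌋ (suc zero)    = s≤s z≤n
⌈n/2⌉≤1+⌊n/2⌋ (suc (suc n)) = s≤s (⌈n/2⌉≤1+⌊n/2⌋ n)

⌊n/2⌋+⌊n/2⌋≤n : ∀ n → ⌊ n /2⌋ ℕ.+ ⌊ n /2⌋ ℕ.≤ n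
⌊n/2⌋+⌊n/2⌋≤n n =
  subst (⌊ n /2⌋ ℕ.+ ⌊ n /2⌋ ℕ.≤_) (ℕₚ.⌊n/2⌋+⌈n/2⌉≡n n) (ℕₚ.+-monoʳ-≤ ⌊ n /2⌋ (ℕₚ.⌊n/2⌋≤⌈n/2⌉ n))

n<2[1+⌊n/2⌋] : ∀ n → n ℕ.< suc ⌊ n /2⌋ ℕ.+ suc ⌊ n /2⌋
n<2[1+⌊n/2⌋] n =
  s≤s (subst (ℕ._≤ ⌊ n /2⌋ ℕ.+ suc ⌊ n /2⌋) (ℕₚ.⌊n/2⌋+⌈n/2⌉≡n n) (ℕₚ.+-monoʳ-≤ ⌊ n /2⌋ (⌈n/2⌉≤1+⌊n/2⌋ n)))

nonZero⇒⌊n/2⌋<n : ∀ n .{{_ : ℕ.NonZero n}} → ⌊ n /2⌋ ℕ.< n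
nonZero⇒⌊n/2⌋<n (suc n) = ℕₚ.⌊n/2⌋<n n

distinct-≤-half : ∀ {a b h p} → a ≢ b → a ℕ.≤ h → b ℕ.≤ h → h ℕ.+ h ℕ.≤ p → a ℕ.+ b ℕ.< p
distinct-≤-half {a} {b} a≢b a≤h b≤h h+h≤p with ℕₚ.<-cmp a b
... | tri< a<b _ _ = ℕₚ.<-≤-trans (ℕₚ.+-mono-<-≤ (ℕₚ.<-≤-trans a<b b≤h) b≤h) h+h≤p
... | tri≈ _ a≡b _ = ⊥-elim (a≢b a≡b)
... | tri> _ _ b<a = ℕₚ.<-≤-trans (ℕₚ.+-mono-≤-< a≤h (ℕₚ.<-≤-trans b<a a≤h)) h+h≤p

pos-a²+b²+1 : ∀ a b → + (a ℕ.* a ℕ.+ b ℕ.* b ℕ.+ 1) ≡ + a * + a + + b * + b + 1ℤ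
pos-a²+b²+1 a b = cong₂ _+_ (cong₂ _+_ (ℤₚ.pos-* a a) (ℤₚ.pos-* b b)) refl

-- The residues of a² and of -1 - b² for 0 ≤ a, b ≤ p/2 are pairwise distinct
-- within each family, and there are more than p of them.
prime∣a²+b²+1 : ∀ {p} → Prime p → ∃₂ λ a b → a ℕ.≤ ⌊ p /2⌋ × b ℕ.≤ ⌊ p /2⌋ × p ∣ a ℕ.* a ℕ.+ b ℕ.* b ℕ.+ 1
prime∣a²+b²+1 {p} p-prime =
  let u , v , u≢v , eq = pigeonhole-⊎ (n<2[1+⌊n/2⌋] p) residue in collide u v u≢v eq
  where
  instance
    p≢0 : ℕ.NonZero p
    p≢0 = prime⇒nonZero p-prime
  h : ℕ
  h = ⌊ p /2⌋
  square : Fin (suc h) → ℤ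
  square a = + toℕ a * + toℕ a
  residue : Fin (suc h) ⊎ Fin (suc h) → Fin p
  residue (inj₁ a) = residueMod p (square a)
  residue (inj₂ b) = residueMod p (- (1ℤ + square b))
  distinct-squares : ∀ {a b} → a ≢ b → ¬ p ∣ ∣ square a - square b ∣
  distinct-squares {a} {b} a≢b = prime∤a²-b² p-prime toℕa≢toℕb
    (distinct-≤-half toℕa≢toℕb (Finₚ.toℕ≤pred[n] a) (Finₚ.toℕ≤pred[n] b) (⌊n/2⌋+⌊n/2⌋≤n p))
    where
    toℕa≢toℕb : toℕ a ≢ toℕ b
    toℕa≢toℕb eq = a≢b (Finₚ.toℕ-injective eq)
  Goal : Set
  Goal = ∃₂ λ a b → a ℕ.≤ h × b ℕ.≤ h × p ∣ a ℕ.* a ℕ.+ b ℕ.* b ℕ.+ 1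
  found : ∀ a b → residue (inj₁ a) ≡ residue (inj₂ b) → Goal
  found a b eq = toℕ a , toℕ b , Finₚ.toℕ≤pred[n] a , Finₚ.toℕ≤pred[n] b ,
    subst (p ∣_) (cong ∣_∣ a²+b²+1≡) (residueMod-≡⇒∣ (square a) (- (1ℤ + square b)) eq)
    where
    rearrange : ∀ a b → a * a - - (1ℤ + b * b) ≡ a * a + b * b + 1ℤ
    rearrange = solve-∀
    a²+b²+1≡ : square a - - (1ℤ + square b) ≡ + (toℕ a ℕ.* toℕ a ℕ.+ toℕ b ℕ.* toℕ b ℕ.+ 1)
    a²+b²+1≡ = trans (rearrange (+ toℕ a) (+ toℕ b)) (sym (pos-a²+b²+1 (toℕ a) (toℕ b)))
  collide : ∀ u v → u ≢ v → residue u ≡ residue v → Goal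
  collide (inj₁ a) (inj₁ b) u≢v eq =
    ⊥-elim (distinct-squares (λ a≡b → u≢v (cong inj₁ a≡b)) (residueMod-≡⇒∣ (square a) (square b) eq))
  collide (inj₂ a) (inj₂ b) u≢v eq =
    ⊥-elim (distinct-squares (λ b≡a → u≢v (cong inj₂ (sym b≡a)))
      (subst (p ∣_) (cong ∣_∣ (swap (+ toℕ a) (+ toℕ b)))
        (residueMod-≡⇒∣ (- (1ℤ + square a)) (- (1ℤ + square b)) eq)))
    where
    swap : ∀ a b → - (1ℤ + a * a) - - (1ℤ + b * b) ≡ b * b - a * a
    swap = solve-∀
  collide (inj₁ a) (inj₂ b) _ eq = found a b eq
  collide (inj₂ b) (inj₁ a) _ eq = found a b (sym eq)

prime-multiple-fourSquares : ∀ {p} → Prime p → ∃ λ m → 0 ℕ.< m × m ℕ.< p × FourSquares (m ℕ.* p)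
prime-multiple-fourSquares {p} p-prime with prime∣a²+b²+1 p-prime
... | a , b , a≤h , b≤h , divides m a²+b²+1≡mp = m , 0<m , m<p , ⟨ + a , + b , 1ℤ , 0ℤ ⟩ , ‖x‖≡mp
  where
  instance
    p≢0 : ℕ.NonZero p
    p≢0 = prime⇒nonZero p-prime
  h : ℕ
  h = ⌊ p /2⌋
  0<m : 0 ℕ.< m
  0<m = ℕₚ.n≢0⇒n>0 λ m≡0 → ℕₚ.1+n≢0 (trans (ℕₚ.+-comm 1 _) (trans a²+b²+1≡mp (cong (ℕ._* p) m≡0)))
  m<h+1 : m ℕ.< suc h
  m<h+1 = ℕₚ.*-cancelʳ-< p m (suc h) (begin-strict
    m ℕ.* p                        ≡⟨ a²+b²+1≡mp ⟨
    a ℕ.* a ℕ.+ b ℕ.* b ℕ.+ 1      ≤⟨ ℕₚ.+-monoˡ-≤ 1 (ℕₚ.+-mono-≤ (ℕₚ.*-mono-≤ a≤h a≤h) (ℕₚ.*-mono-≤ b≤h b≤h)) ⟩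
    h ℕ.* h ℕ.+ h ℕ.* h ℕ.+ 1      ≡⟨ cong (ℕ._+ 1) (ℕₚ.*-distribˡ-+ h h h) ⟨
    h ℕ.* (h ℕ.+ h) ℕ.+ 1          ≤⟨ ℕₚ.+-monoˡ-≤ 1 (ℕₚ.*-monoʳ-≤ h (⌊n/2⌋+⌊n/2⌋≤n p)) ⟩
    h ℕ.* p ℕ.+ 1                  <⟨ ℕₚ.+-monoʳ-< (h ℕ.* p) (ℕ.nonTrivial⇒n>1 p {{prime⇒nonTrivial p-prime}}) ⟩
    h ℕ.* p ℕ.+ p                  ≡⟨ ℕₚ.+-comm (h ℕ.* p) p ⟩
    suc h ℕ.* p                    ∎)
    where open ℕₚ.≤-Reasoning
  m<p : m ℕ.< p
  m<p = ℕₚ.<-≤-trans m<h+1 (nonZero⇒⌊n/2⌋<n p)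
  ‖x‖≡mp : ‖ ⟨ + a , + b , 1ℤ , 0ℤ ⟩ ‖ ≡ + (m ℕ.* p)
  ‖x‖≡mp = trans (ℤₚ.+-identityʳ _) (trans (sym (pos-a²+b²+1 a b)) (cong +_ a²+b²+1≡mp))

multiple⇒fourSquares : ∀ {p} → Prime p → ∀ m → 0 ℕ.< m → m ℕ.< p → FourSquares (m ℕ.* p) → FourSquares p
multiple⇒fourSquares {p} p-prime = <-rec _ step
  where
  step : ∀ m → (∀ {r} → r ℕ.< m → 0 ℕ.< r → r ℕ.< p → FourSquares (r ℕ.* p) → FourSquares p) →
         0 ℕ.< m → m ℕ.< p → FourSquares (m ℕ.* p) → FourSquares p
  step (suc zero)    _   _ _   sq = subst FourSquares (ℕₚ.*-identityˡ p) sq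
  step (suc (suc m)) rec _ m<p sq =
    let r , 0<r , r<m , sq′ = descent p-prime (s≤s (s≤s z≤n)) m<p sq
    in  rec r<m 0<r (ℕₚ.<-trans r<m m<p) sq′

prime⇒fourSquares : ∀ {p} → Prime p → FourSquares p
prime⇒fourSquares p-prime =
  let m , 0<m , m<p , sq = prime-multiple-fourSquares p-prime
  in  multiple⇒fourSquares p-prime m 0<m m<p sq

fourSquares-product : ∀ {ps} → All Prime ps → FourSquares (product ps)
fourSquares-product []                 = real 1ℤ , refl
fourSquares-product (p-prime ∷ primes) = fourSquares-* (prime⇒fourSquares p-prime) (fourSquares-product primes)

lagrange : ∀ n → FourSquares n
lagrange zero    = real 0ℤ , refl
lagrange (suc n) = subst FourSquares (sym isFactorisation) (fourSquares-product factorsPrime)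
  where open PrimeFactorisation (factorise (suc n))


renameᵗ : ∀ {n m} → (Fin n → Fin m) → Term n → Term m
renameᵗ r (var i) = var (r i)
renameᵗ r zeroᵗ   = zeroᵗ
renameᵗ r oneᵗ    = oneᵗ
renameᵗ r 𝔭ᵗ      = 𝔭ᵗ
renameᵗ r εᵗ      = εᵗ
renameᵗ r 𝐢ᵗ      = 𝐢ᵗ
renameᵗ r (s ⊕ t) = renameᵗ r s ⊕ renameᵗ r t
renameᵗ r (s ⊗ t) = renameᵗ r s ⊗ renameᵗ r t
renameᵗ r (⊖ t)   = ⊖ renameᵗ r t

rename : ∀ {n m} → (Fin n → Fin m) → Formula n → Formula m
rename r (s ≐ t)  = renameᵗ r s ≐ renameᵗ r t
rename r ⊥ᶠ       = ⊥ᶠ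
rename r (¬ᶠ φ)   = ¬ᶠ rename r φ
rename r (φ ∧ᶠ ψ) = rename r φ ∧ᶠ rename r ψ
rename r (φ ∨ᶠ ψ) = rename r φ ∨ᶠ rename r ψ
rename r (φ ⇒ᶠ ψ) = rename r φ ⇒ᶠ rename r ψ
rename r (∀ᶠ φ)   = ∀ᶠ (rename (lift 1 r) φ)
rename r (∃ᶠ φ)   = ∃ᶠ (rename (lift 1 r) φ)

-- ∀ y (θ(x̄, y) → Φ(y)): for θ the graph of f, it expresses Φ(f(x̄)).
pullback : ∀ {k} → Formula (suc k) → Formula 1 → Formula k
pullback θ Φ = ∀ᶠ (θ ⇒ᶠ rename (λ _ → zero) Φ)

sumOfFourSquaresᶠ : Formula 1
sumOfFourSquaresᶠ = ∃ᶠ (∃ᶠ (∃ᶠ (∃ᶠ (var (# 4) ≐ (((sq (# 3) ⊕ sq (# 2)) ⊕ sq (# 1)) ⊕ sq (# 0))))))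
  where
  sq : Fin 5 → Term 5
  sq i = var i ⊗ var i

module FirstOrder (D : PSet → Set) (D-ultra : IsUltrafilter D) (𝔭 ε 𝐢 : Ultrapower.*ℤ D) where
  open Ultrapower D
  open Semantics D 𝔭 ε 𝐢
  open IsUltrafilter D-ultra

  ≈-refl : ∀ {x} → x ≈ x
  ≈-refl = upward _ _ (λ _ _ → refl) full

  ≈-sym : ∀ {x y} → x ≈ y → y ≈ x
  ≈-sym = upward _ _ (λ _ → sym)

  ≈-trans : ∀ {x y z} → x ≈ y → y ≈ z → x ≈ z
  ≈-trans x≈y y≈z = upward _ _ (λ _ (e , e′) → trans e e′) (inter _ _ x≈y y≈z)

  ≈-cong : ∀ (op : ℤ → ℤ) {x y} → x ≈ y → (λ p → op (x p)) ≈ (λ p → op (y p))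
  ≈-cong op = upward _ _ (λ _ → cong op)

  ≈-cong₂ : ∀ (op : ℤ → ℤ → ℤ) {x x′ y y′} → x ≈ x′ → y ≈ y′ →
            (λ p → op (x p) (y p)) ≈ (λ p → op (x′ p) (y′ p))
  ≈-cong₂ op x≈x′ y≈y′ = upward _ _ (λ _ (e , e′) → cong₂ op e e′) (inter _ _ x≈x′ y≈y′)

  ⟦renameᵗ⟧ : ∀ {n m} {r : Fin n → Fin m} {σ ρ} → (∀ i → σ (r i) ≈ ρ i) → ∀ t → ⟦ renameᵗ r t ⟧ᵗ σ ≈ ⟦ t ⟧ᵗ ρ
  ⟦renameᵗ⟧ σ≈ρ (var i) = σ≈ρ i
  ⟦renameᵗ⟧ σ≈ρ zeroᵗ   = ≈-refl
  ⟦renameᵗ⟧ σ≈ρ oneᵗ    = ≈-refl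
  ⟦renameᵗ⟧ σ≈ρ 𝔭ᵗ      = ≈-refl
  ⟦renameᵗ⟧ σ≈ρ εᵗ      = ≈-refl
  ⟦renameᵗ⟧ σ≈ρ 𝐢ᵗ      = ≈-refl
  ⟦renameᵗ⟧ σ≈ρ (s ⊕ t) = ≈-cong₂ ℤ._+_ (⟦renameᵗ⟧ σ≈ρ s) (⟦renameᵗ⟧ σ≈ρ t)
  ⟦renameᵗ⟧ σ≈ρ (s ⊗ t) = ≈-cong₂ ℤ._*_ (⟦renameᵗ⟧ σ≈ρ s) (⟦renameᵗ⟧ σ≈ρ t)
  ⟦renameᵗ⟧ σ≈ρ (⊖ t)   = ≈-cong ℤ.-_ (⟦renameᵗ⟧ σ≈ρ t)

  ∷ᵉ-lift : ∀ {n m} {r : Fin n → Fin m} {σ ρ} → (∀ i → σ (r i) ≈ ρ i) →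
            ∀ a i → (a ∷ᵉ σ) (lift 1 r i) ≈ (a ∷ᵉ ρ) i
  ∷ᵉ-lift σ≈ρ a zero    = ≈-refl
  ∷ᵉ-lift σ≈ρ a (suc i) = σ≈ρ i

  ⊨-rename : ∀ {n m} {r : Fin n → Fin m} {σ ρ} → (∀ i → σ (r i) ≈ ρ i) →
             ∀ φ → σ ⊨ rename r φ ⇔ ρ ⊨ φ
  ⊨-rename σ≈ρ (s ≐ t)  = mk⇔ (λ e → ≈-trans (≈-sym (⟦renameᵗ⟧ σ≈ρ s)) (≈-trans e (⟦renameᵗ⟧ σ≈ρ t)))
                               (λ e → ≈-trans (⟦renameᵗ⟧ σ≈ρ s) (≈-trans e (≈-sym (⟦renameᵗ⟧ σ≈ρ t))))
  ⊨-rename σ≈ρ ⊥ᶠ       = mk⇔ (λ ()) (λ ())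
  ⊨-rename σ≈ρ (¬ᶠ φ)   = ¬-cong-⇔ (⊨-rename σ≈ρ φ)
  ⊨-rename σ≈ρ (φ ∧ᶠ ψ) = ⊨-rename σ≈ρ φ ×-⇔ ⊨-rename σ≈ρ ψ
  ⊨-rename σ≈ρ (φ ∨ᶠ ψ) = ⊨-rename σ≈ρ φ ⊎-⇔ ⊨-rename σ≈ρ ψ
  ⊨-rename σ≈ρ (φ ⇒ᶠ ψ) = →-cong-⇔ (⊨-rename σ≈ρ φ) (⊨-rename σ≈ρ ψ)
  ⊨-rename σ≈ρ (∀ᶠ φ)   = mk⇔ (λ g a → to (⊨-rename (∷ᵉ-lift σ≈ρ a) φ) (g a))
                               (λ g a → from (⊨-rename (∷ᵉ-lift σ≈ρ a) φ) (g a))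
  ⊨-rename σ≈ρ (∃ᶠ φ)   = mk⇔ (λ (a , s) → a , to (⊨-rename (∷ᵉ-lift σ≈ρ a) φ) s)
                               (λ (a , s) → a , from (⊨-rename (∷ᵉ-lift σ≈ρ a) φ) s)

  ⊨-pullback : ∀ {k} {f : (Fin k → *ℤ) → *ℤ} ((θ , θ-graph) : Definable f) →
               ∀ Φ ρ {y} → f ρ ≈ y → ρ ⊨ pullback θ Φ ⇔ (λ _ → y) ⊨ Φ
  ⊨-pullback {f = f} (θ , θ-graph) Φ ρ fρ≈y = mk⇔
    (λ ⊨Φ∘f → to (⊨-rename (λ _ → fρ≈y) Φ) (⊨Φ∘f (f ρ) (proj₂ (θ-graph ρ (f ρ)) ≈-refl)))
    (λ ⊨Φ y′ θ[ρ,y′] → from (⊨-rename (λ _ → ≈-trans (≈-sym (proj₁ (θ-graph ρ y′) θ[ρ,y′])) fρ≈y) Φ) ⊨Φ)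

  definable-image-generic :
    ∀ {k} {L : Fin k → *ℤ} {f : (Fin k → *ℤ) → *ℤ} → FiniteGeneric L → Definable f →
    ((l : Fin k → ℕ) → Σ ℕ λ m → f (λ i → embℕ (l i)) ≈ embℕ m) → FiniteGeneric {1} (λ _ → f L)
  definable-image-generic {L = L} L-generic f-definable f-standard Φ Φ-standard =
    to (⊨-pullback f-definable Φ L ≈-refl) (L-generic (pullback (proj₁ f-definable) Φ) λ l →
      let m , fl≈m = f-standard l in from (⊨-pullback f-definable Φ _ fl≈m) (Φ-standard (λ _ → m)))

  sumOfFourSquares-standard : ∀ (l : Fin 1 → ℕ) → (λ i → embℕ (l i)) ⊨ sumOfFourSquaresᶠ
  sumOfFourSquares-standard l =
    let x , ‖x‖≡l = lagrange (l zero)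
    in  embℤ (ℍ.re x) , embℤ (ℍ.i x) , embℤ (ℍ.j x) , embℤ (ℍ.k x) , upward _ _ (λ _ _ → sym ‖x‖≡l) full

  sumOfFourSquares⇒nonNeg : ∀ y → (λ _ → y) ⊨ sumOfFourSquaresᶠ → 0* ≤* y
  sumOfFourSquares⇒nonNeg y (a , b , c , d , y≈‖abcd‖) = upward _ _ nonNeg y≈‖abcd‖
    where
    nonNeg : ∀ p → y p ≡ ‖ ⟨ a p , b p , c p , d p ⟩ ‖ → 0ℤ ℤ.≤ y p
    nonNeg p eq = subst (0ℤ ℤ.≤_) (sym (trans eq (norm≡normℕ ⟨ a p , b p , c p , d p ⟩))) (+≤+ z≤n)

mainTheorem2 : (D : PSet → Set) → IsUltrafilter D → NonPrincipal D →
    (𝔭 ε 𝐢 : Ultrapower.*ℤ D) →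
    Ultrapower.IsPrime* D 𝔭 →
    Ultrapower._≤*_ D (Ultrapower.0* D) ε → Ultrapower._<*_ D ε 𝔭 →
    (k : ℕ) (L : Fin k → Ultrapower.*ℤ D) →
    Semantics.FiniteGeneric D 𝔭 ε 𝐢 L →
    (f : (Fin k → Ultrapower.*ℤ D) → Ultrapower.*ℤ D) →
    Semantics.Definable D 𝔭 ε 𝐢 f →
    ((l : Fin k → ℕ) → Σ ℕ (λ m →
      Ultrapower._≈_ D (f (λ i → Ultrapower.embℕ D (l i))) (Ultrapower.embℕ D m))) →
    Semantics.FiniteGeneric D 𝔭 ε 𝐢 {1} (λ _ → f L)
      × Ultrapower._≤*_ D (Ultrapower.0* D) (f L)
mainTheorem2 D D-ultra _ 𝔭 ε 𝐢 _ _ _ k L L-generic f f-definable f-standard =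
  fL-generic , sumOfFourSquares⇒nonNeg (f L) (fL-generic sumOfFourSquaresᶠ sumOfFourSquares-standard)
  where
  open FirstOrder D D-ultra 𝔭 ε 𝐢
  fL-generic : Semantics.FiniteGeneric D 𝔭 ε 𝐢 {1} (λ _ → f L)
  fL-generic = definable-image-generic L-generic f-definable f-standard
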